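{- Let $F$ be a field with valuation $v:F\to\Gamma\cup\{\infty\}$ and lift $C$ of the residue field, and let $(f,\alpha)\mapsto f|_\alpha:F\times\Gamma\to F$ satisfy (T1)–(T5) below. Assume (T6): for all $f,g\in F$ and $\gamma\in\Gamma$, if $\operatorname{sp}(f)+\operatorname{sp}(g)<\gamma$ then $\operatorname{sp}(fg)<\gamma$. Then for all $f,g\in F$, $\operatorname{sp}(fg)\subseteq\operatorname{sp}(f)+\operatorname{sp}(g)$.
   Context: $\Gamma$ is an additively written ordered abelian group (total translation-invariant order); $v$ is a Krull valuation of $F$ with valuation ring $\mathcal O=\{f:vf\ge0\}$; $C$ is a subfield of $F$ contained in $\mathcal O$ mapped bijectively onto the residue field by the residue map. For $f\in F$, $\operatorname{sp}(f)=\{\gamma\in\Gamma: v(f-f|_\gamma)=\gamma\}$. For $A,B\subseteq\Gamma$, $A+B=\{a+b:a\in A,b\in B\}$, and $A<\gamma$ means every element of $A$ is $<\gamma$. The truncation satisfies for all $f,g\in F$, $c\in C$, $\alpha,\beta\in\Gamma$: (T1) $v(f-f|_\alpha)\ge\alpha$; (T2) $v(f)\ge\alpha\Rightarrow f|_\alpha=0$; (T3) $\beta>\alpha\Rightarrow(f|_\alpha)|_\beta=f|_\alpha$; (T4) $(f+g)|_\alpha=f|_\alpha+g|_\alpha$ and $(cf)|_\alpha=c\cdot(f|_\alpha)$; (T5) $\operatorname{sp}(f)$ is wellordered. -}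

module Defs where

open import Level using (Level; _⊔_) renaming (suc to lsuc)
open import Data.Product using (Σ; ∃; ∃-syntax; _×_; _,_)
open import Data.Sum using (_⊎_)
open import Relation.Binary.PropositionalEquality using (_≡_; _≢_)
open import Relation.Nullary using (¬_)
open import Data.Unit using (⊤)
open import Data.Empty using (⊥)
open import Algebra.Structures using (IsCommutativeRing; IsAbelianGroup)
open import Relation.Binary.Structures using (IsTotalOrder)

data WithInfty {a : Level} (Γ : Set a) : Set a where
  fin : Γ → WithInfty Γ
  ∞   : WithInfty Γ

module InftyOps {a : Level} {Γ : Set a} (_≤_ : Γ → Γ → Set a)
                (_⊕_ : Γ → Γ → Γ) where
  infix 4 _≤∞_ _<∞_
  _≤∞_ : WithInfty Γ → WithInfty Γ → Set a
  fin x ≤∞ fin y = x ≤ y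
  _     ≤∞ ∞     = Level.Lift a ⊤
  ∞     ≤∞ fin _ = Level.Lift a ⊥

  _<∞_ : WithInfty Γ → WithInfty Γ → Set a
  x <∞ y = (x ≤∞ y) × (x ≢ y)

  _⊕∞_ : WithInfty Γ → WithInfty Γ → WithInfty Γ
  fin x ⊕∞ fin y = fin (x ⊕ y)
  fin _ ⊕∞ ∞     = ∞
  ∞     ⊕∞ _     = ∞

record ValuedFieldWithLift (a : Level) : Set (lsuc a) where
  infixl 6 _+_ _-_ _⊕_
  infixl 7 _*_
  infix 4 _≤_ _<_
  field
    F    : Set a
    _+_  : F → F → F
    _*_  : F → F → F
    -_   : F → F
    0#   : F
    1#   : F
    isCommutativeRing : IsCommutativeRing _≡_ _+_ _*_ -_ 0# 1#
    0≢1  : 0# ≢ 1#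
    inverse : ∀ x → x ≢ 0# → ∃[ y ] (x * y ≡ 1#)
    Γ    : Set a
    _⊕_  : Γ → Γ → Γ
    ⊖_   : Γ → Γ
    𝟘    : Γ
    isAbelianGroup : IsAbelianGroup _≡_ _⊕_ 𝟘 ⊖_
    _≤_  : Γ → Γ → Set a
    isTotalOrder : IsTotalOrder _≡_ _≤_
    ≤-translation : ∀ x y z → x ≤ y → x ⊕ z ≤ y ⊕ z

  _-_ : F → F → F
  x - y = x + (- y)

  _<_ : Γ → Γ → Set a
  x < y = (x ≤ y) × (x ≢ y)

  open InftyOps _≤_ _⊕_ public

  field
    v : F → WithInfty Γ
    v-∞⇒0 : ∀ x → v x ≡ ∞ → x ≡ 0#
    v-0   : v 0# ≡ ∞
    v-*   : ∀ x y → v (x * y) ≡ v x ⊕∞ v y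
    -- v(x+y) ≥ min(v x, v y)
    v-+   : ∀ x y → (v x ≤∞ v (x + y)) ⊎ (v y ≤∞ v (x + y))
    -- the lift C of the residue field: a subfield of F ...
    C      : F → Set a
    C-0    : C 0#
    C-1    : C 1#
    C-+    : ∀ x y → C x → C y → C (x + y)
    C-neg  : ∀ x → C x → C (- x)
    C-*    : ∀ x y → C x → C y → C (x * y)
    C-inv  : ∀ x y → C x → x * y ≡ 1# → C y
    -- ... contained in the valuation ring O = {f : v f ≥ 0} ...
    C⊆O    : ∀ x → C x → fin 𝟘 ≤∞ v x
    -- ... mapped onto the residue field by the residue map (surjective) ...
    C-onto : ∀ f → fin 𝟘 ≤∞ v f → ∃[ c ] (C c × (fin 𝟘 <∞ v (f - c)))
    -- ... injectively.
    C-into : ∀ c d → C c → C d → fin 𝟘 <∞ v (c - d) → c ≡ d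

module _ {a : Level} (K : ValuedFieldWithLift a) where
  open ValuedFieldWithLift K

  sp : (F → Γ → F) → F → Γ → Set a
  sp tr f γ = v (f - tr f γ) ≡ fin γ

  WellOrdered : (Γ → Set a) → Set (lsuc a)
  WellOrdered A = (P : Γ → Set a) → (∀ x → P x → A x) → ∃[ x ] P x →
                  ∃[ m ] (P m × (∀ x → P x → m ≤ x))

  _<ˢ_ : (Γ → Set a) → Γ → Set a
  A <ˢ γ = ∀ x → A x → x < γ

  SumBelow : (Γ → Set a) → (Γ → Set a) → Γ → Set a
  SumBelow A B γ = ∀ x y → A x → B y → x ⊕ y < γ

  InSum : (Γ → Set a) → (Γ → Set a) → Γ → Set a
  InSum A B γ = ∃[ x ] ∃[ y ] (A x × B y × (x ⊕ y ≡ γ))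

  T1 T2 T3 T4 T5 T6 : (F → Γ → F) → Set (lsuc a)
  T1 tr = Level.Lift (lsuc a) (∀ f α → fin α ≤∞ v (f - tr f α))
  T2 tr = Level.Lift (lsuc a) (∀ f α → fin α ≤∞ v f → tr f α ≡ 0#)
  T3 tr = Level.Lift (lsuc a) (∀ f α β → α < β → tr (tr f α) β ≡ tr f α)
  T4 tr = Level.Lift (lsuc a) ((∀ f g α → tr (f + g) α ≡ tr f α + tr g α)
                              × (∀ c f α → C c → tr (c * f) α ≡ c * tr f α))
  T5 tr = ∀ f → WellOrdered (sp tr f)
  T6 tr = Level.Lift (lsuc a)
            (∀ f g γ → SumBelow (sp tr f) (sp tr g) γ → sp tr (f * g) <ˢ γ)

{-# OPTIONS --safe #-}
module Submission where

-- Suppose γ ∈ sp(fg) but γ ∉ sp(f) + sp(g). By (T6) some c ∈ sp(f) and b ∈ sp(g)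
-- have c + b > γ; take b least. Split g = g|b + g′: every element of
-- sp(f) + sp(g|b) is ≤ γ and ≠ γ, so (T6) gives γ ∉ sp(f·g|b), hence γ ∈ sp(f g′).
-- Split f = f|δ + f′ with δ = γ − b: since δ ∉ sp(f), v(f′) > δ, and v(g′) ≥ b, so
-- v(f′g′) > γ and γ ∈ sp(f|δ · g′). Thus (f|δ, g′) is again a counterexample, with
-- sp(f|δ) ⊆ sp(f) bounded by δ < c ∈ sp(f); repeating this contradicts the
-- well-ordering of sp(f).

open import Defs
open import Level using (Level; lift; lower)
open import Axiom.ExcludedMiddle using (ExcludedMiddle)
open import Axiom.DoubleNegationElimination using (em⇒dne)
open import Algebra.Bundles using (AbelianGroup; CommutativeRing)
import Algebra.Properties.AbelianGroup as AbelianGroupProperties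
import Algebra.Properties.CommutativeSemigroup as CommutativeSemigroupProperties
import Algebra.Properties.Ring as RingProperties
open import Data.Empty using (⊥-elim)
open import Data.Product using (∃-syntax; _×_; _,_; proj₁; proj₂)
open import Data.Sum using (_⊎_; inj₁; inj₂)
open import Data.Unit using (tt)
open import Function using (_∘_; id)
open import Relation.Binary.Bundles using (TotalOrder)
import Relation.Binary.Construct.NonStrictToStrict as ToStrict
import Relation.Binary.Properties.TotalOrder as TotalOrderProperties
open import Relation.Binary.PropositionalEquality
open import Relation.Nullary using (¬_; yes; no)
open import Relation.Unary using (_⊆′_)

module ValuedFieldProperties {a : Level} (K : ValuedFieldWithLift a) where
  open ValuedFieldWithLift K
  open ≡-Reasoning

  F-commutativeRing : CommutativeRing a a
  F-commutativeRing = record { isCommutativeRing = isCommutativeRing }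

  Γ-abelianGroup : AbelianGroup a a
  Γ-abelianGroup = record { isAbelianGroup = isAbelianGroup }

  Γ-totalOrder : TotalOrder a a a
  Γ-totalOrder = record { isTotalOrder = isTotalOrder }

  module FR = CommutativeRing F-commutativeRing
  module ΓA = AbelianGroup Γ-abelianGroup
  module ΓP = AbelianGroupProperties Γ-abelianGroup
  module ≤Γ = TotalOrder Γ-totalOrder
  open TotalOrderProperties Γ-totalOrder public using (<-irrefl; <-trans; <⇒≱; ≰⇒>)

  private
    module F+ = AbelianGroupProperties FR.+-abelianGroup
    module F+S = CommutativeSemigroupProperties FR.+-commutativeSemigroup

  x+[y-x]≡y : ∀ x y → x + (y - x) ≡ y
  x+[y-x]≡y x y = trans (FR.+-comm x (y - x)) (F+.//-rightDividesˡ x y)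

  x-0≡x : ∀ x → x - 0# ≡ x
  x-0≡x x = trans (cong (x +_) F+.ε⁻¹≈ε) (FR.+-identityʳ x)

  [x+y]-[z+w]≡[x-z]+[y-w] : ∀ x y z w → (x + y) - (z + w) ≡ (x - z) + (y - w)
  [x+y]-[z+w]≡[x-z]+[y-w] x y z w =
    trans (cong ((x + y) +_) (sym (F+.⁻¹-∙-comm z w))) (F+S.interchange x y (- z) (- w))

  x-[y+z]≡x-y-z : ∀ x y z → x - (y + z) ≡ (x - y) - z
  x-[y+z]≡x-y-z x y z = trans (cong (x +_) (sym (F+.⁻¹-∙-comm y z))) (sym (FR.+-assoc x (- y) (- z)))

  [y-z]+[x-y]≡x-z : ∀ x y z → (y - z) + (x - y) ≡ x - z
  [y-z]+[x-y]≡x-z x y z = begin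
    (y - z) + (x - y)    ≡⟨ FR.+-comm (y - z) (x - y) ⟩
    (x - y) + (y - z)    ≡⟨ FR.+-assoc x (- y) (y - z) ⟩
    x + (- y + (y - z))  ≡⟨ cong (x +_) (F+.\\-leftDividesʳ y (- z)) ⟩
    x - z                ∎

  x*y≡x*z+x*[y-z] : ∀ x y z → x * y ≡ x * z + x * (y - z)
  x*y≡x*z+x*[y-z] x y z = trans (cong (x *_) (sym (x+[y-x]≡y z y))) (FR.distribˡ x z (y - z))

  x*y≡z*y+[x-z]*y : ∀ x y z → x * y ≡ z * y + (x - z) * y
  x*y≡z*y+[x-z]*y x y z = trans (cong (_* y) (sym (x+[y-x]≡y z x))) (FR.distribʳ y z (x - z))

  <-≤-trans : ∀ {x y z} → x < y → y ≤ z → x < z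
  <-≤-trans = ToStrict.<-≤-trans _≡_ _≤_ sym ≤Γ.trans ≤Γ.antisym ≤Γ.≤-respʳ-≈

  ⊕-cancelʳ : ∀ {x y} z → x ⊕ z ≡ y ⊕ z → x ≡ y
  ⊕-cancelʳ {x} {y} z eq =
    trans (sym (ΓP.//-rightDividesʳ z x)) (trans (cong (_⊕ ⊖ z) eq) (ΓP.//-rightDividesʳ z y))

  ⊕-monoˡ-< : ∀ {x y} z → x < y → x ⊕ z < y ⊕ z
  ⊕-monoˡ-< {x} {y} z (x≤y , x≢y) = ≤-translation x y z x≤y , x≢y ∘ ⊕-cancelʳ z

  ⊕-monoʳ-≤ : ∀ {x y} z → x ≤ y → z ⊕ x ≤ z ⊕ y
  ⊕-monoʳ-≤ {x} {y} z x≤y = subst₂ _≤_ (ΓA.comm x z) (ΓA.comm y z) (≤-translation x y z x≤y)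

  ⊕-mono-<-≤ : ∀ {p q r s} → p < r → q ≤ s → p ⊕ q < r ⊕ s
  ⊕-mono-<-≤ {q = q} {r} p<r q≤s = <-≤-trans (⊕-monoˡ-< q p<r) (⊕-monoʳ-≤ r q≤s)

  x<y⊕z⇒x⊖z<y : ∀ {x y z} → x < y ⊕ z → x ⊕ ⊖ z < y
  x<y⊕z⇒x⊖z<y {x} {y} {z} x<y⊕z = subst (x ⊕ ⊖ z <_) (ΓP.//-rightDividesʳ z y) (⊕-monoˡ-< (⊖ z) x<y⊕z)

  x⊕x≡𝟘⇒x≡𝟘 : ∀ {x} → x ⊕ x ≡ 𝟘 → x ≡ 𝟘
  x⊕x≡𝟘⇒x≡𝟘 {x} x⊕x≡𝟘 with ≤Γ.total x 𝟘
  ... | inj₁ x≤𝟘 = ≤Γ.antisym x≤𝟘 (subst₂ _≤_ x⊕x≡𝟘 (ΓA.identityˡ x) (≤-translation x 𝟘 x x≤𝟘))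
  ... | inj₂ 𝟘≤x = ≤Γ.antisym (subst₂ _≤_ (ΓA.identityˡ x) x⊕x≡𝟘 (≤-translation 𝟘 x x 𝟘≤x)) 𝟘≤x

  fin-injective : ∀ {x y : Γ} → fin x ≡ fin y → x ≡ y
  fin-injective refl = refl

  ≤∞-∞ : ∀ x → x ≤∞ ∞
  ≤∞-∞ (fin _) = lift tt
  ≤∞-∞ ∞       = lift tt

  ≤∞-trans : ∀ {x y z} → x ≤∞ y → y ≤∞ z → x ≤∞ z
  ≤∞-trans {fin _} {fin _} {fin _} x≤y y≤z = ≤Γ.trans x≤y y≤z
  ≤∞-trans {x}     {_}     {∞}     _   _   = ≤∞-∞ x
  ≤∞-trans {_}     {∞}     {fin _} _   (lift ())
  ≤∞-trans {∞}     {fin _} {fin _} (lift ()) _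

  ≤∞-antisym : ∀ {x y} → x ≤∞ y → y ≤∞ x → x ≡ y
  ≤∞-antisym {fin _} {fin _} x≤y y≤x = cong fin (≤Γ.antisym x≤y y≤x)
  ≤∞-antisym {fin _} {∞}     _   (lift ())
  ≤∞-antisym {∞}     {fin _} (lift ()) _
  ≤∞-antisym {∞}     {∞}     _   _   = refl

  ≤∞-total : ∀ x y → x ≤∞ y ⊎ y ≤∞ x
  ≤∞-total (fin x) (fin y) = ≤Γ.total x y
  ≤∞-total (fin _) ∞       = inj₁ (lift tt)
  ≤∞-total ∞       y       = inj₂ (≤∞-∞ y)

  <-≤∞-trans : ∀ {x y z} → x < y → fin y ≤∞ z → fin x <∞ z
  <-≤∞-trans {z = fin _} x<y y≤z = let (x≤z , x≢z) = <-≤-trans x<y y≤z in x≤z , x≢z ∘ fin-injective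
  <-≤∞-trans {z = ∞}     _   _   = lift tt , λ ()

  ⊕∞-identityˡ : ∀ x → fin 𝟘 ⊕∞ x ≡ x
  ⊕∞-identityˡ (fin x) = cong fin (ΓA.identityˡ x)
  ⊕∞-identityˡ ∞       = refl

  ⊕∞-mono-<-≤ : ∀ {p q x y} → fin p <∞ x → fin q ≤∞ y → fin (p ⊕ q) <∞ x ⊕∞ y
  ⊕∞-mono-<-≤ {x = fin _} {fin _} (p≤x , p≢x) q≤y =
    let (p⊕q≤ , p⊕q≢) = ⊕-mono-<-≤ (p≤x , p≢x ∘ cong fin) q≤y in p⊕q≤ , p⊕q≢ ∘ fin-injective
  ⊕∞-mono-<-≤ {x = fin _} {∞} _ _ = lift tt , λ ()
  ⊕∞-mono-<-≤ {x = ∞}         _ _ = lift tt , λ ()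

  idempotent⇒fin𝟘 : ∀ {x} → x ≢ ∞ → x ⊕∞ x ≡ x → x ≡ fin 𝟘
  idempotent⇒fin𝟘 {fin x} _ x⊕x≡x = cong fin (ΓP.identityʳ-unique x x (fin-injective x⊕x≡x))
  idempotent⇒fin𝟘 {∞} x≢∞ _ = ⊥-elim (x≢∞ refl)

  x⊕∞x≡fin𝟘⇒x≡fin𝟘 : ∀ {x} → x ⊕∞ x ≡ fin 𝟘 → x ≡ fin 𝟘
  x⊕∞x≡fin𝟘⇒x≡fin𝟘 {fin x} eq = cong fin (x⊕x≡𝟘⇒x≡𝟘 (fin-injective eq))

  v-1 : v 1# ≡ fin 𝟘
  v-1 = idempotent⇒fin𝟘 (0≢1 ∘ sym ∘ v-∞⇒0 1#)
          (trans (sym (v-* 1# 1#)) (cong v (FR.*-identityˡ 1#)))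

  v-[-1] : v (- 1#) ≡ fin 𝟘
  v-[-1] = x⊕∞x≡fin𝟘⇒x≡fin𝟘 (begin
    v (- 1#) ⊕∞ v (- 1#)  ≡⟨ sym (v-* (- 1#) (- 1#)) ⟩
    v ((- 1#) * (- 1#))   ≡⟨ cong v (RingProperties.-1*x≈-x FR.ring (- 1#)) ⟩
    v (- (- 1#))          ≡⟨ cong v (F+.⁻¹-involutive 1#) ⟩
    v 1#                  ≡⟨ v-1 ⟩
    fin 𝟘                 ∎)

  v-neg : ∀ x → v (- x) ≡ v x
  v-neg x = begin
    v (- x)             ≡⟨ cong v (sym (RingProperties.-1*x≈-x FR.ring x)) ⟩
    v ((- 1#) * x)      ≡⟨ v-* (- 1#) x ⟩
    v (- 1#) ⊕∞ v x     ≡⟨ cong (_⊕∞ v x) v-[-1] ⟩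
    fin 𝟘 ⊕∞ v x        ≡⟨ ⊕∞-identityˡ (v x) ⟩
    v x                 ∎

  v-+-strict : ∀ {x y γ} → v x ≡ fin γ → fin γ <∞ v y → v (x + y) ≡ fin γ
  v-+-strict {x} {y} {γ} vx≡γ (γ≤vy , γ≢vy) = ≤∞-antisym upper lower-bound
    where
    lower-bound : fin γ ≤∞ v (x + y)
    lower-bound with v-+ x y
    ... | inj₁ vx≤ = subst (_≤∞ v (x + y)) vx≡γ vx≤
    ... | inj₂ vy≤ = ≤∞-trans {fin γ} {v y} γ≤vy vy≤
    v[[x+y]-y]≡γ : v ((x + y) - y) ≡ fin γ
    v[[x+y]-y]≡γ = trans (cong v (F+.//-rightDividesʳ y x)) vx≡γ
    upper : v (x + y) ≤∞ fin γ
    upper with v-+ (x + y) (- y)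
    ... | inj₁ ≤γ = subst (v (x + y) ≤∞_) v[[x+y]-y]≡γ ≤γ
    ... | inj₂ vy≤γ = ⊥-elim (γ≢vy (sym (≤∞-antisym (subst₂ _≤∞_ (v-neg y) v[[x+y]-y]≡γ vy≤γ) γ≤vy)))

  v-+-min-attained : ∀ {x y γ} → v (x + y) ≡ fin γ → fin γ ≤∞ v x → fin γ ≤∞ v y →
                     v x ≡ fin γ ⊎ v y ≡ fin γ
  v-+-min-attained {x} {y} {γ} v[x+y]≡γ γ≤vx γ≤vy with v-+ x y
  ... | inj₁ vx≤ = inj₁ (≤∞-antisym (subst (v x ≤∞_) v[x+y]≡γ vx≤) γ≤vx)
  ... | inj₂ vy≤ = inj₂ (≤∞-antisym (subst (v y ≤∞_) v[x+y]≡γ vy≤) γ≤vy)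

  v-*-< : ∀ {x y p q} → fin p <∞ v x → fin q ≤∞ v y → fin (p ⊕ q) <∞ v (x * y)
  v-*-< {x} {y} p<vx q≤vy = subst (fin _ <∞_) (sym (v-* x y)) (⊕∞-mono-<-≤ p<vx q≤vy)

  InSum-mono : ∀ {A A′ B B′ : Γ → Set a} {γ} → A ⊆′ A′ → B ⊆′ B′ →
               InSum K A B γ → InSum K A′ B′ γ
  InSum-mono A⊆A′ B⊆B′ (x , y , x∈A , y∈B , x⊕y≡γ) = x , y , A⊆A′ x x∈A , B⊆B′ y y∈B , x⊕y≡γ

  DescendsAlong : {X : Set a} → (X → Γ → Set a) → (X → Set a) → Set a
  DescendsAlong S Bad =
    ∀ x → Bad x → ∃[ y ] ∃[ c ] (Bad y × S x c × S y ⊆′ S x × (∀ p → S y p → p < c))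

  no-descent : {X : Set a} (S : X → Γ → Set a) (Bad : X → Set a) →
               DescendsAlong S Bad → ∀ x → WellOrdered K (S x) → ¬ Bad x
  no-descent S Bad descend x wo bad-x =
    let (y , c , bad-y , c∈Sx , Sy⊆Sx , Sy<c) = descend x bad-x
        (m , (_ , z , bad-z , Sz⊆Sx , Sz<m) , m-least) =
          wo Bounds (λ _ → proj₁) (c , c∈Sx , y , bad-y , Sy⊆Sx , Sy<c)
        (w , d , bad-w , d∈Sz , Sw⊆Sz , Sw<d) = descend z bad-z
    in <-irrefl refl (<-≤-trans (Sz<m d d∈Sz)
         (m-least d (Sz⊆Sx d d∈Sz , w , bad-w , (λ p → Sz⊆Sx p ∘ Sw⊆Sz p) , Sw<d)))
    where
    Bounds : Γ → Set a
    Bounds c = S x c × ∃[ y ] (Bad y × S y ⊆′ S x × (∀ p → S y p → p < c))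

module TruncationProperties {a : Level} (K : ValuedFieldWithLift a) (lem : ExcludedMiddle a)
  (tr : ValuedFieldWithLift.F K → ValuedFieldWithLift.Γ K → ValuedFieldWithLift.F K)
  (t1 : T1 K tr) (t2 : T2 K tr) (t3 : T3 K tr) (t4 : T4 K tr) where
  open ValuedFieldWithLift K
  open ValuedFieldProperties K
  open ≡-Reasoning

  Sp : F → Γ → Set a
  Sp = sp K tr

  tail-≥ : ∀ f α → fin α ≤∞ v (f - tr f α)
  tail-≥ = lower t1

  tr-≡0 : ∀ f α → fin α ≤∞ v f → tr f α ≡ 0#
  tr-≡0 = lower t2

  tr-tr-< : ∀ f α β → α < β → tr (tr f α) β ≡ tr f α
  tr-tr-< = lower t3

  tr-+ : ∀ f g α → tr (f + g) α ≡ tr f α + tr g α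
  tr-+ = proj₁ (lower t4)

  tr-split : ∀ f α β → tr f β ≡ tr (tr f α) β + tr (f - tr f α) β
  tr-split f α β = trans (cong (λ h → tr h β) (sym (x+[y-x]≡y (tr f α) f))) (tr-+ (tr f α) (f - tr f α) β)

  tr-tr-≤ : ∀ f {α β} → β ≤ α → tr (tr f α) β ≡ tr f β
  tr-tr-≤ f {α} {β} β≤α = begin
    tr (tr f α) β                      ≡⟨ sym (FR.+-identityʳ _) ⟩
    tr (tr f α) β + 0#                 ≡⟨ cong (tr (tr f α) β +_) (sym (tr-≡0 (f - tr f α) β β≤v[f-f|α])) ⟩
    tr (tr f α) β + tr (f - tr f α) β  ≡⟨ sym (tr-split f α β) ⟩
    tr f β                             ∎
    where
    β≤v[f-f|α] : fin β ≤∞ v (f - tr f α)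
    β≤v[f-f|α] = ≤∞-trans {fin β} {fin α} {v (f - tr f α)} β≤α (tail-≥ f α)

  tr-tr-≥ : ∀ f {α β} → α ≤ β → tr (tr f α) β ≡ tr f α
  tr-tr-≥ f {α} {β} α≤β with lem {α ≡ β}
  ... | yes refl = tr-tr-≤ f α≤β
  ... | no α≢β = tr-tr-< f α β (α≤β , α≢β)

  sp-≤v⇒v≡ : ∀ {f γ} → Sp f γ → fin γ ≤∞ v f → v f ≡ fin γ
  sp-≤v⇒v≡ {f} {γ} γ∈f γ≤vf = trans (cong v (sym (trans (cong (λ h → f - h) (tr-≡0 f γ γ≤vf)) (x-0≡x f)))) γ∈f

  sp⇒v≤ : ∀ {f γ} → Sp f γ → v f ≤∞ fin γ
  sp⇒v≤ {f} {γ} γ∈f with ≤∞-total (v f) (fin γ)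
  ... | inj₁ vf≤γ = vf≤γ
  ... | inj₂ γ≤vf = subst (_≤∞ fin γ) (sym (sp-≤v⇒v≡ γ∈f γ≤vf)) ≤Γ.refl

  ¬sp-<v : ∀ {f γ} → fin γ <∞ v f → ¬ Sp f γ
  ¬sp-<v (γ≤vf , γ≢vf) γ∈f = γ≢vf (sym (sp-≤v⇒v≡ γ∈f γ≤vf))

  ¬sp⇒tail-> : ∀ {f α} → ¬ Sp f α → fin α <∞ v (f - tr f α)
  ¬sp⇒tail-> {f} {α} α∉f = tail-≥ f α , α∉f ∘ sym

  sp-+ : ∀ f g {γ} → Sp (f + g) γ → Sp f γ ⊎ Sp g γ
  sp-+ f g {γ} γ∈f+g = v-+-min-attained (trans (cong v (sym tails)) γ∈f+g) (tail-≥ f γ) (tail-≥ g γ)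
    where
    tails : (f + g) - tr (f + g) γ ≡ (f - tr f γ) + (g - tr g γ)
    tails = trans (cong (λ h → (f + g) - h) (tr-+ f g γ)) ([x+y]-[z+w]≡[x-z]+[y-w] f g (tr f γ) (tr g γ))

  sp-+-resolveˡ : ∀ {f g γ} → ¬ Sp g γ → Sp (f + g) γ → Sp f γ
  sp-+-resolveˡ {f} {g} γ∉g γ∈f+g with sp-+ f g γ∈f+g
  ... | inj₁ γ∈f = γ∈f
  ... | inj₂ γ∈g = ⊥-elim (γ∉g γ∈g)

  sp-+-resolveʳ : ∀ {f g γ} → ¬ Sp f γ → Sp (f + g) γ → Sp g γ
  sp-+-resolveʳ {f} {g} γ∉f γ∈f+g with sp-+ f g γ∈f+g
  ... | inj₁ γ∈f = ⊥-elim (γ∉f γ∈f)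
  ... | inj₂ γ∈g = γ∈g

  ¬sp-tr-≥ : ∀ f {α γ} → α ≤ γ → ¬ Sp (tr f α) γ
  ¬sp-tr-≥ f {α} {γ} α≤γ γ∈f|α with () ← begin
    fin γ                          ≡⟨ sym γ∈f|α ⟩
    v (tr f α - tr (tr f α) γ)     ≡⟨ cong (λ h → v (tr f α - h)) (tr-tr-≥ f α≤γ) ⟩
    v (tr f α - tr f α)            ≡⟨ cong v (FR.-‿inverseʳ (tr f α)) ⟩
    v 0#                           ≡⟨ v-0 ⟩
    ∞                              ∎

  sp-tr : ∀ f {α γ} → Sp (tr f α) γ → Sp f γ × γ < α
  sp-tr f {α} {γ} γ∈f|α = γ∈f , γ<α
    where
    γ<α : γ < α
    γ<α = ≰⇒> (λ α≤γ → ¬sp-tr-≥ f α≤γ γ∈f|α)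
    v-head : v (tr f α - tr f γ) ≡ fin γ
    v-head = trans (cong (λ h → v (tr f α - h)) (sym (tr-tr-≤ f (proj₁ γ<α)))) γ∈f|α
    γ∈f : Sp f γ
    γ∈f = begin
      v (f - tr f γ)                        ≡⟨ cong v (sym ([y-z]+[x-y]≡x-z f (tr f α) (tr f γ))) ⟩
      v ((tr f α - tr f γ) + (f - tr f α))  ≡⟨ v-+-strict v-head (<-≤∞-trans γ<α (tail-≥ f α)) ⟩
      fin γ                                 ∎

  sp-tail : ∀ f {β γ} → Sp (f - tr f β) γ → Sp f γ
  sp-tail f {β} {γ} γ∈tail = begin
    v (f - tr f γ)                   ≡⟨ cong (λ h → v (f - h)) (tr-split f β γ) ⟩
    v (f - (tr (tr f β) γ + tr t γ)) ≡⟨ cong (λ h → v (f - (h + tr t γ))) (tr-tr-≥ f β≤γ) ⟩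
    v (f - (tr f β + tr t γ))        ≡⟨ cong v (x-[y+z]≡x-y-z f (tr f β) (tr t γ)) ⟩
    v (t - tr t γ)                   ≡⟨ γ∈tail ⟩
    fin γ                            ∎
    where
    t = f - tr f β
    β≤γ : β ≤ γ
    β≤γ = ≤∞-trans {fin β} {v t} {fin γ} (tail-≥ f β) (sp⇒v≤ γ∈tail)

module SupportOfProducts {a : Level} (K : ValuedFieldWithLift a) (lem : ExcludedMiddle a)
  (tr : ValuedFieldWithLift.F K → ValuedFieldWithLift.Γ K → ValuedFieldWithLift.F K)
  (t1 : T1 K tr) (t2 : T2 K tr) (t3 : T3 K tr) (t4 : T4 K tr) (t5 : T5 K tr) (t6 : T6 K tr)
  (γ : ValuedFieldWithLift.Γ K) where
  open ValuedFieldWithLift K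
  open ValuedFieldProperties K
  open TruncationProperties K lem tr t1 t2 t3 t4

  private
    dne : ∀ {P : Set a} → ¬ ¬ P → P
    dne = em⇒dne lem

  Counterexample : F × F → Set a
  Counterexample (f , g) = Sp (f * g) γ × ¬ InSum K (Sp f) (Sp g) γ

  ¬sp-* : ∀ {f g} → (∀ p q → Sp f p → Sp g q → p ⊕ q ≤ γ) → ¬ InSum K (Sp f) (Sp g) γ →
          ¬ Sp (f * g) γ
  ¬sp-* {f} {g} sums≤γ γ∉sums γ∈fg = <-irrefl refl (lower t6 f g γ sums<γ γ γ∈fg)
    where
    sums<γ : ∀ p q → Sp f p → Sp g q → p ⊕ q < γ
    sums<γ p q p∈f q∈g = sums≤γ p q p∈f q∈g , λ p⊕q≡γ → γ∉sums (p , q , p∈f , q∈g , p⊕q≡γ)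

  sp-*-dropʳ : ∀ {f g β} → (∀ p q → Sp f p → Sp g q → q < β → p ⊕ q ≤ γ) →
               ¬ InSum K (Sp f) (Sp g) γ → Sp (f * g) γ → Sp (f * (g - tr g β)) γ
  sp-*-dropʳ {f} {g} {β} sums≤γ γ∉sums γ∈fg =
    sp-+-resolveʳ γ∉f·g|β (subst (λ h → Sp h γ) (x*y≡x*z+x*[y-z] f g (tr g β)) γ∈fg)
    where
    γ∉f·g|β : ¬ Sp (f * tr g β) γ
    γ∉f·g|β = ¬sp-*
      (λ p q p∈f q∈g|β → let (q∈g , q<β) = sp-tr g q∈g|β in sums≤γ p q p∈f q∈g q<β)
      (γ∉sums ∘ InSum-mono (λ _ → id) (λ _ → proj₁ ∘ sp-tr g))

  sp-*-truncateˡ : ∀ {f h δ β} → fin β ≤∞ v h → ¬ Sp f δ → δ ⊕ β ≡ γ →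
                   Sp (f * h) γ → Sp (tr f δ * h) γ
  sp-*-truncateˡ {f} {h} {δ} β≤vh δ∉f δ⊕β≡γ γ∈fh =
    sp-+-resolveˡ γ∉tail·h (subst (λ x → Sp x γ) (x*y≡z*y+[x-z]*y f h (tr f δ)) γ∈fh)
    where
    γ∉tail·h : ¬ Sp ((f - tr f δ) * h) γ
    γ∉tail·h = ¬sp-<v (subst (λ ε → fin ε <∞ v ((f - tr f δ) * h)) δ⊕β≡γ
                                (v-*-< (¬sp⇒tail-> δ∉f) β≤vh))

  Overshoot : F → F → Γ → Set a
  Overshoot f g b = Sp g b × ∃[ c ] (Sp f c × ¬ (c ⊕ b ≤ γ))

  overshoot-exists : ∀ {f g} → Counterexample (f , g) → ∃[ b ] Overshoot f g b
  overshoot-exists (γ∈fg , γ∉sums) = dne λ none →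
    ¬sp-* (λ p q p∈f q∈g → dne λ p⊕q≰γ → none (q , q∈g , p , p∈f , p⊕q≰γ)) γ∉sums γ∈fg

  descend : DescendsAlong (Sp ∘ proj₁) Counterexample
  descend (f , g) (γ∈fg , γ∉sums)
    with t5 g (Overshoot f g) (λ _ → proj₁) (overshoot-exists (γ∈fg , γ∉sums))
  ... | b , (b∈g , c , c∈f , c⊕b≰γ) , b-least =
    (tr f δ , g - tr g b) , c , (γ∈f′g′ , γ∉sums ∘ InSum-mono f′⊆f (λ _ → sp-tail g)) ,
    c∈f , f′⊆f , λ p p∈f′ → <-trans (proj₂ (sp-tr f p∈f′)) δ<c
    where
    δ : Γ
    δ = γ ⊕ ⊖ b
    δ⊕b≡γ : δ ⊕ b ≡ γ
    δ⊕b≡γ = ΓP.//-rightDividesˡ b γ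
    δ<c : δ < c
    δ<c = x<y⊕z⇒x⊖z<y (≰⇒> c⊕b≰γ)
    f′⊆f : Sp (tr f δ) ⊆′ Sp f
    f′⊆f _ = proj₁ ∘ sp-tr f
    sums≤γ : ∀ p q → Sp f p → Sp g q → q < b → p ⊕ q ≤ γ
    sums≤γ p q p∈f q∈g q<b = dne λ p⊕q≰γ → <⇒≱ q<b (b-least q (q∈g , p , p∈f , p⊕q≰γ))
    δ∉f : ¬ Sp f δ
    δ∉f δ∈f = γ∉sums (δ , b , δ∈f , b∈g , δ⊕b≡γ)
    γ∈f′g′ : Sp (tr f δ * (g - tr g b)) γ
    γ∈f′g′ = sp-*-truncateˡ (tail-≥ g b) δ∉f δ⊕b≡γ (sp-*-dropʳ sums≤γ γ∉sums γ∈fg)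

open ValuedFieldWithLift using (F; Γ; _*_)

lemma3p2 : {a : Level} → ExcludedMiddle a → (K : ValuedFieldWithLift a) →
    (tr : F K → Γ K → F K) →
    T1 K tr → T2 K tr → T3 K tr → T4 K tr → T5 K tr → T6 K tr →
    ∀ f g γ → sp K tr (_*_ K f g) γ → InSum K (sp K tr f) (sp K tr g) γ
lemma3p2 lem K tr t1 t2 t3 t4 t5 t6 f g γ γ∈fg = em⇒dne lem λ γ∉sums →
  no-descent (Sp ∘ proj₁) Counterexample descend (f , g) (t5 f) (γ∈fg , γ∉sums)
  where
  open ValuedFieldProperties K
  open TruncationProperties K lem tr t1 t2 t3 t4
  open SupportOfProducts K lem tr t1 t2 t3 t4 t5 t6 γ
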